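{- Let $S[1..n]$ be a string over $\Sigma=\{1,\dots,\sigma\}$ ending with a unique smallest sentinel, with suffix array $SA$ and BWT $L$, and let $\mathcal{S}$ be the set of suffix array ranges $(s,e)$ that backward search can visit for patterns occurring in $S$. Consider a VLB-tree on $L$ and a child $u_2$ of its root whose fragment is $L^{u_2}=L[p..q]$. Let $(a,b)=lmo(p,q)$ and $(y,z)=rmo(p,q)$, and let $\Sigma^{(a,p-1)}$ and $\Sigma^{(q+1,z)}$ be the sets of symbols occurring in $L[a..p-1]$ and $L[q+1..z]$ respectively (empty if the corresponding overlap set is empty). Then the routing array $u_2.Z$ can be sampled so that it stores entries only for symbols in $\Sigma^{(a,p-1)}\cup\Sigma^{(q+1,z)}$, and $backwardsearch(P)$ (computing $(sp_1,ep_1)$ and the toehold $SA[sp_1]$) still returns the correct result for every pattern $P$ that occurs in $S$.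
   Context: BWT: $L[j]=S[SA[j]-1]$ if $SA[j]\ne1$, else $L[j]=\$$. $C[c]$ is the number of symbols of $S$ smaller than $c$; $rank_c(L,i)$ is the number of occurrences of $c$ in $L[1..i]$. Backward search for $P[1..m]$ starts with $(sp_{m+1},ep_{m+1})=(1,n)$ and for $l=m+1,\dots,2$ sets $sp_{l-1}=C[P[l-1]]+rank_{P[l-1]}(L,sp_l-1)+1$, $ep_{l-1}=C[P[l-1]]+rank_{P[l-1]}(L,ep_l)$; $SA[sp_l..ep_l]$ are the suffixes prefixed by $P[l..m]$. In the VLB-tree, $sp_{l-1}$ is computed via $headrank_{c}(L,sp_l)=(o,\beta)$, where $o=rank_c(L,sp_l)$ and $\beta=1$ iff $L[sp_l]=c$, using $o-\beta$ in place of $rank_c(L,sp_l-1)$. The toehold: let $g$ be the smallest step with $L[sp_g]\ne P[g-1]$ (with $g=m+1$, $sp_g=1$ initially), let $L[h_\rho..t_\rho]$ be the run containing $succ_{P[g-1]}(L,sp_g)$ (the nearest occurrence of $P[g-1]$ at or after $sp_g$), and $SA[sp_1]=SA[h_\rho]-(m-g+2)$. VLB-tree: $L$ is split into top-level blocks of length $\ell$; the root's children are fragments of $L$ (consecutive blocks with at most $w$ runs merged into leaves, or single blocks with more runs that are recursively subdivided). Each root child $u$ stores an array $Z$ where $Z[c]$ points to the nearest right-hand sibling (child of the root) whose fragment contains $c$; each node stores prefix counts of its symbols before its fragment. When a rank/headrank query at $i\in[p..q]$ with symbol $c$ not occurring in $L[p..q]$ arrives, the answer (number of occurrences of $c$ before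 $L[p..q]$) is read at the node pointed to by $u_2.Z[c]$; successor queries at $i\in[p..q]$ with no occurrence of $c$ in $L[i..q]$ likewise continue at the node pointed to by $u_2.Z[c]$. If $Z$ has no entry for $c$ (after sampling), such rank/headrank queries return $0$ and successor queries return null. Overlaps: $\mathcal{L}(p,q)=\{(s,e)\in\mathcal{S}: s\le p\le e\le q\}$, $\mathcal{R}(p,q)=\{(s,e)\in\mathcal{S}: p\le s\le q\le e\}$; $lmo(p,q)$ is the element of $\mathcal{L}(p,q)$ with minimum $s$ (ties: largest $e$), and $rmo(p,q)$ is the element of $\mathcal{R}(p,q)$ with maximum $e$ (ties: smallest $s$). -}

module Defs where

open import Data.Nat using (ℕ; zero; suc; _+_; _∸_; _≤_; _<_; _≤ᵇ_; _<ᵇ_; _≡ᵇ_)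
open import Data.Nat.Divisibility using (_∣_)
open import Data.Bool using (Bool; true; false; if_then_else_; _∧_; not)
open import Data.List using (List; []; _∷_; map; upTo; length)
open import Data.Nat.ListAction using (sum)
open import Data.Bool.ListAction using (any)
open import Data.List.Relation.Binary.Lex.Strict using (Lex-<)
open import Data.Maybe using (Maybe; just; nothing)
open import Data.Product using (_×_; _,_; Σ; ∃; ∃-syntax)
open import Data.Sum using (_⊎_)
open import Relation.Binary.PropositionalEquality using (_≡_)
open import Data.List.Relation.Unary.All using (All)

-- Conventions: all strings/arrays are 1-based, modelled as functions ℕ → ℕ
-- that are meaningful on positions 1..n.  Symbols are naturals; the
-- sentinel $ is the symbol 0 and Σ = {1,…,σ}.

interval : ℕ → ℕ → List ℕ
interval i j = map (i +_) (upTo (suc j ∸ i))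

cnt : (ℕ → Bool) → List ℕ → ℕ
cnt f xs = sum (map (λ k → if f k then 1 else 0) xs)

IsText : ℕ → ℕ → (ℕ → ℕ) → Set
IsText n σ S =
  (1 ≤ n) × (S n ≡ 0) × (∀ i → 1 ≤ i → i < n → (1 ≤ S i) × (S i ≤ σ))

suffix : ℕ → (ℕ → ℕ) → ℕ → List ℕ
suffix n S i = map S (interval i n)

IsSuffixArray : ℕ → (ℕ → ℕ) → (ℕ → ℕ) → Set
IsSuffixArray n S SA =
  (∀ j → 1 ≤ j → j ≤ n → (1 ≤ SA j) × (SA j ≤ n)) ×
  (∀ j j′ → 1 ≤ j → j < j′ → j′ ≤ n →
     Lex-< _≡_ _<_ (suffix n S (SA j)) (suffix n S (SA j′)))

BWT : (ℕ → ℕ) → (ℕ → ℕ) → ℕ → ℕ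
BWT S SA j = if SA j ≡ᵇ 1 then 0 else S (SA j ∸ 1)

Ccount : ℕ → (ℕ → ℕ) → ℕ → ℕ
Ccount n S c = cnt (λ i → S i <ᵇ c) (interval 1 n)

rank : (ℕ → ℕ) → ℕ → ℕ → ℕ
rank L c i = cnt (λ j → L j ≡ᵇ c) (interval 1 i)

occursB : (ℕ → ℕ) → ℕ → ℕ → ℕ → Bool
occursB L c i j = any (λ k → L k ≡ᵇ c) (interval i j)

firstOcc : (ℕ → ℕ) → ℕ → List ℕ → Maybe ℕ
firstOcc L c [] = nothing
firstOcc L c (k ∷ ks) = if L k ≡ᵇ c then just k else firstOcc L c ks

succL : ℕ → (ℕ → ℕ) → ℕ → ℕ → Maybe ℕ
succL n L c i = firstOcc L c (interval i n)

runHead : (ℕ → ℕ) → ℕ → ℕ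
runHead L zero = zero
runHead L (suc zero) = suc zero
runHead L (suc (suc k)) =
  if L (suc k) ≡ᵇ L (suc (suc k)) then runHead L (suc k) else suc (suc k)

-- For P = P[1..m]: bsRange [] = (sp_{m+1}, ep_{m+1}) = (1, n), and
-- bsRange (c ∷ P') computes (sp,ep) of c·P' from those of P'.
bsRange : ℕ → (ℕ → ℕ) → (ℕ → ℕ) → List ℕ → ℕ × ℕ
bsRange n S SA [] = 1 , n
bsRange n S SA (c ∷ P) with bsRange n S SA P
... | sp , ep =
  Ccount n S c + rank (BWT S SA) c (sp ∸ 1) + 1 ,
  Ccount n S c + rank (BWT S SA) c ep

Occurs : ℕ → (ℕ → ℕ) → List ℕ → Set
Occurs n S P = ∃[ i ] ((1 ≤ i) × (i + length P ≤ suc n) ×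
                       (map (λ k → S (i + k)) (upTo (length P)) ≡ P))

-- the set 𝒮 of ranges backward search can visit for patterns occurring
-- in S (the ranges of all suffixes, including the empty one, of such patterns,
-- i.e. of all patterns occurring in S)
-- patterns are strings over Σ = {1..σ}
IsPattern : ℕ → List ℕ → Set
IsPattern σ Q = All (λ x → (1 ≤ x) × (x ≤ σ)) Q

InRanges : ℕ → ℕ → (ℕ → ℕ) → (ℕ → ℕ) → ℕ → ℕ → Set
InRanges n σ S SA s e =
  ∃[ Q ] (IsPattern σ Q × Occurs n S Q × (bsRange n S SA Q ≡ (s , e)))

module _ (n σ : ℕ) (S SA : ℕ → ℕ) (p q : ℕ) where

  InLeft : ℕ → ℕ → Set
  InLeft s e = InRanges n σ S SA s e × (s ≤ p) × (p ≤ e) × (e ≤ q)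

  InRight : ℕ → ℕ → Set
  InRight s e = InRanges n σ S SA s e × (p ≤ s) × (s ≤ q) × (q ≤ e)

  IsLmo : ℕ → ℕ → Set
  IsLmo a b = InLeft a b ×
    (∀ s e → InLeft s e → (a < s) ⊎ ((a ≡ s) × (e ≤ b)))

  IsRmo : ℕ → ℕ → Set
  IsRmo y z = InRight y z ×
    (∀ s e → InRight s e → (e < z) ⊎ ((e ≡ z) × (y ≤ s)))

  InSigmaLeft : ℕ → Set
  InSigmaLeft c = ∃[ a ] ∃[ b ] (IsLmo a b ×
    ∃[ j ] ((a ≤ j) × (j ≤ p ∸ 1) × (BWT S SA j ≡ c)))

  InSigmaRight : ℕ → Set
  InSigmaRight c = ∃[ y ] ∃[ z ] (IsRmo y z ×
    ∃[ j ] ((suc q ≤ j) × (j ≤ z) × (BWT S SA j ≡ c)))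

-- L[p..q] is the fragment of a child of the root of a VLB-tree with
-- top-level block length ℓ: it is a nonempty union of consecutive
-- top-level blocks of L[1..n].
IsRootFragment : ℕ → ℕ → ℕ → ℕ → Set
IsRootFragment n ℓ p q =
  (1 ≤ ℓ) × (1 ≤ p) × (p ≤ q) × (q ≤ n) × (ℓ ∣ (p ∸ 1)) × ((ℓ ∣ q) ⊎ (q ≡ n))

record Oracle : Set where
  field
    rk : ℕ → ℕ → ℕ
    hr : ℕ → ℕ → ℕ × Bool
    sc : ℕ → ℕ → Maybe ℕ

-- VLB-tree answers when the routing array u₂.Z of the root child with
-- fragment L[p..q] keeps entries only for the symbols c with K c ≡ true
-- (all other nodes/arrays exact): a rank/headrank query at i ∈ [p..q]
-- with c not occurring in L[p..q], or a successor query at i ∈ [p..q]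
-- with c not occurring in L[i..q], is routed through u₂.Z[c]; if that
-- entry was dropped, rank/headrank return 0 and successor returns null.
-- All other queries return the correct answer.
sampledOracle : ℕ → (ℕ → ℕ) → ℕ → ℕ → (ℕ → Bool) → Oracle
sampledOracle n L p q K = record
  { rk = λ c i → if inFrag i ∧ not (occursB L c p q) ∧ not (K c)
                 then 0 else rank L c i
  ; hr = λ c i → if inFrag i ∧ not (occursB L c p q) ∧ not (K c)
                 then (0 , false) else (rank L c i , (L i ≡ᵇ c))
  ; sc = λ c i → if inFrag i ∧ not (occursB L c i q) ∧ not (K c)
                 then nothing else succL n L c i
  }
  where
  inFrag : ℕ → Bool
  inFrag i = (p ≤ᵇ i) ∧ (i ≤ᵇ q)

-- State: (sp, ep, toehold) where toehold = SA[sp] once computed.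
-- At each step with symbol c: (o,β) = headrank_c(L,sp),
-- sp' = C[c] + (o - β) + 1, ep' = C[c] + rank_c(L,ep);
-- if β = 1 (and a toehold is known) then SA[sp'] = SA[sp] - 1,
-- otherwise SA[sp'] = SA[h_ρ] - 1 where L[h_ρ..t_ρ] is the run containing
-- succ_c(L,sp) (initially, sp_{m+1} = 1, this lookup is always made).

bwStep : ℕ → (ℕ → ℕ) → (ℕ → ℕ) → Oracle → ℕ →
         ℕ × ℕ × Maybe ℕ → Maybe (ℕ × ℕ × Maybe ℕ)
bwStep n S SA O c (sp , ep , t) with Oracle.hr O c sp
... | o , β = go β t
  where
  sp′ : ℕ
  sp′ = Ccount n S c + (o ∸ (if β then 1 else 0)) + 1
  ep′ : ℕ
  ep′ = Ccount n S c + Oracle.rk O c ep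
  viaSucc : Maybe (ℕ × ℕ × Maybe ℕ)
  viaSucc with Oracle.sc O c sp
  ... | nothing = nothing
  ... | just j  = just (sp′ , ep′ , just (SA (runHead (BWT S SA) j) ∸ 1))
  go : Bool → Maybe ℕ → Maybe (ℕ × ℕ × Maybe ℕ)
  go true (just t₀) = just (sp′ , ep′ , just (t₀ ∸ 1))
  go _    _         = viaSucc

backwardSearch : ℕ → (ℕ → ℕ) → (ℕ → ℕ) → Oracle → List ℕ →
                 Maybe (ℕ × ℕ × Maybe ℕ)
backwardSearch n S SA O [] = just (1 , n , nothing)
backwardSearch n S SA O (c ∷ P) with backwardSearch n S SA O P
... | nothing = nothing
... | just st = bwStep n S SA O c st

correctResult : ℕ → (ℕ → ℕ) → (ℕ → ℕ) → List ℕ → Maybe (ℕ × ℕ × Maybe ℕ)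
correctResult n S SA P with bsRange n S SA P
... | sp , ep = just (sp , ep , just (SA sp))

{-# OPTIONS --safe #-}
module Submission where

-- Backward search for an occurring pattern c ∷ P queries only rank/headrank of c at sp(P)
-- and ep(P) and succ_c at sp(P), and c occurs in L at some row j ∈ [sp(P), ep(P)]: the row of
-- the suffix following an occurrence of c ∷ P.  A query inside the fragment L[p..q] at which
-- c is missing from the relevant part of the fragment therefore has j outside it.  If j > q,
-- then (sp(P), ep(P)) ∈ 𝓡(p,q), so c occurs in L[q+1..z] for the rmo (y,z); if j < p, then
-- (sp(P), ep(P)) ∈ 𝓛(p,q), so c occurs in L[a..p-1] for the lmo (a,b).  Keeping exactly
-- these symbols in u₂.Z thus makes every query of the search exact, and what remains is the
-- correctness of backward search with toeholds, which rests on the LF-mapping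
-- isa i = C[S i] + rank_{S i}(L, isa (i+1) - 1) + 1, proved by counting suffixes.  The
-- set 𝒮 is decidable (it suffices to search the factors of S), so lmo and rmo exist
-- constructively as soon as the overlap sets are nonempty.

open import Defs
open import Data.Bool using (Bool; true; false; T; not; _∧_; _∨_; if_then_else_)
open import Data.Bool.Properties using (if-cong; T-≡; T-∨)
open import Data.Bool.ListAction using (any)
open import Data.List using (List; []; _∷_; _++_; [_]; map; upTo; applyUpTo; length)
open import Data.List.Properties
  using (map-++; map-∘; map-cong; map-upTo; upTo-∷ʳ; length-map; length-upTo; ∷-injective)
open import Data.List.Membership.Propositional using (_∈_; find; lose)
open import Data.List.Membership.Propositional.Properties using (∈-map⁺; ∈-map⁻; ∈-upTo⁺; ∈-upTo⁻)
open import Data.List.Relation.Binary.Lex.Core using (this; next)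
open import Data.List.Relation.Binary.Lex.Strict using (Lex-<; <-irreflexive; <-asymmetric)
open import Data.List.Relation.Binary.Pointwise.Properties using () renaming (refl to pointwise-refl)
open import Data.List.Relation.Unary.All using ([]; _∷_; all?) renaming (head to All-head; tail to All-tail)
open import Data.List.Relation.Unary.Any using (here; there)
open import Data.List.Relation.Unary.Any.Properties using (any⁺; any⁻)
open import Data.Maybe using (Maybe; just; nothing; fromMaybe)
open import Data.Maybe.Properties using (just-injective)
open import Data.Nat
open import Data.Nat.ListAction using (sum)
open import Data.Nat.ListAction.Properties using (sum-++)
open import Data.Nat.Properties
open import Algebra.Properties.CommutativeSemigroup +-commutativeSemigroup using (interchange)
open import Data.Product using (_×_; _,_; proj₁; proj₂; ∃-syntax)
open import Data.Product.Properties using (≡-dec)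
open import Data.Sum using (_⊎_; inj₁; inj₂; swap) renaming (map to ⊎-map)
open import Data.Unit using (⊤; tt)
open import Function using (_∘_; _⇔_; mk⇔; Equivalence)
open import Relation.Binary.Definitions using (tri<; tri≈; tri>)
open import Relation.Binary.PropositionalEquality
  using (_≡_; _≢_; refl; sym; trans; cong; cong₂; subst; subst₂; resp₂; module ≡-Reasoning)
open import Relation.Nullary using (¬_; Dec; yes; no; does; contradiction)
open import Relation.Nullary.Decidable using (map′; toSum; dec-true; dec-false; does-⇔; _×-dec_; ¬?)
open import Relation.Unary using (Decidable)

-- Counting and bounded search

_∈[_⋯_] : ℕ → ℕ → ℕ → Set
x ∈[ i ⋯ j ] = i ≤ x × x ≤ j

⋯-weaken : ∀ {x i j} → x ∈[ i ⋯ j ] → x ∈[ i ⋯ suc j ]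
⋯-weaken (i≤x , x≤j) = i≤x , m≤n⇒m≤1+n x≤j

⋯-last : ∀ {N} → suc N ∈[ 1 ⋯ suc N ]
⋯-last = s≤s z≤n , ≤-refl

indicator : Bool → ℕ
indicator b = if b then 1 else 0

count : {P : ℕ → Set} → Decidable P → ℕ → ℕ
count P? zero    = 0
count P? (suc N) = count P? N + indicator (does (P? (suc N)))

indicator-split : {A B C : Set} (A? : Dec A) (B? : Dec B) (C? : Dec C) → A ⇔ (B ⊎ C) → ¬ (B × C) →
                  indicator (does A?) ≡ indicator (does B?) + indicator (does C?)
indicator-split (yes _) (yes b) (yes c) _   excl = contradiction (b , c) excl
indicator-split (yes _) (yes _) (no _)  _   _    = refl
indicator-split (yes _) (no _)  (yes _) _   _    = refl
indicator-split (yes a) (no ¬b) (no ¬c) A⇔B⊎C _ with Equivalence.to A⇔B⊎C a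
... | inj₁ b = contradiction b ¬b
... | inj₂ c = contradiction c ¬c
indicator-split (no ¬a) (yes b) _       A⇔B⊎C _ = contradiction (Equivalence.from A⇔B⊎C (inj₁ b)) ¬a
indicator-split (no ¬a) (no _)  (yes c) A⇔B⊎C _ = contradiction (Equivalence.from A⇔B⊎C (inj₂ c)) ¬a
indicator-split (no _)  (no _)  (no _)  _   _    = refl

module _ {P : ℕ → Set} (P? : Decidable P) where

  count-≤ : ∀ N → count P? N ≤ N
  count-≤ zero = z≤n
  count-≤ (suc N) with P? (suc N)
  ... | yes _ = subst (_≤ suc N) (+-comm 1 (count P? N)) (s≤s (count-≤ N))
  ... | no  _ = subst (_≤ suc N) (sym (+-identityʳ _)) (m≤n⇒m≤1+n (count-≤ N))

  count-mono : ∀ {M N} → M ≤ N → count P? M ≤ count P? N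
  count-mono {N = zero} z≤n = ≤-refl
  count-mono {M} {suc N} M≤1+N with m≤n⇒m<n∨m≡n M≤1+N
  ... | inj₂ refl  = ≤-refl
  ... | inj₁ M<1+N = ≤-trans (count-mono (≤-pred M<1+N)) (m≤m+n _ _)

  count-stable : ∀ {M N} → M ≤ N → (∀ {x} → M < x → x ≤ N → ¬ P x) → count P? N ≡ count P? M
  count-stable {N = zero} z≤n _ = refl
  count-stable {M} {suc N} M≤1+N none with m≤n⇒m<n∨m≡n M≤1+N
  ... | inj₂ refl  = refl
  ... | inj₁ M<1+N = begin
    count P? N + indicator (does (P? (suc N)))
      ≡⟨ cong (λ b → count P? N + indicator b) (dec-false (P? (suc N)) (none M<1+N ≤-refl)) ⟩
    count P? N + 0
      ≡⟨ +-identityʳ _ ⟩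
    count P? N
      ≡⟨ count-stable (≤-pred M<1+N) (λ M<x x≤N → none M<x (m≤n⇒m≤1+n x≤N)) ⟩
    count P? M ∎
    where open ≡-Reasoning

  count-all : ∀ N → (∀ {x} → x ∈[ 1 ⋯ N ] → P x) → count P? N ≡ N
  count-all zero    _   = refl
  count-all (suc N) all with P? (suc N)
  ... | yes _ = trans (+-comm _ 1) (cong suc (count-all N (all ∘ ⋯-weaken)))
  ... | no ¬P = contradiction (all ⋯-last) ¬P

module _ {P Q : ℕ → Set} (P? : Decidable P) (Q? : Decidable Q) where

  count-cong : ∀ N → (∀ {x} → x ∈[ 1 ⋯ N ] → P x ⇔ Q x) → count P? N ≡ count Q? N
  count-cong zero    _   = refl
  count-cong (suc N) P⇔Q = cong₂ _+_ (count-cong N (P⇔Q ∘ ⋯-weaken))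
                                     (cong indicator (does-⇔ (P⇔Q ⋯-last) (P? (suc N)) (Q? (suc N))))

module _ {P Q R : ℕ → Set} (P? : Decidable P) (Q? : Decidable Q) (R? : Decidable R) where

  count-split : ∀ N → (∀ {x} → x ∈[ 1 ⋯ N ] → P x ⇔ (Q x ⊎ R x)) → (∀ {x} → ¬ (Q x × R x)) →
                count P? N ≡ count Q? N + count R? N
  count-split zero    _    _    = refl
  count-split (suc N) P⇔Q⊎R excl = begin
    count P? N + indicator (does (P? (suc N)))
      ≡⟨ cong₂ _+_ (count-split N (P⇔Q⊎R ∘ ⋯-weaken) excl)
                   (indicator-split (P? (suc N)) (Q? (suc N)) (R? (suc N)) (P⇔Q⊎R ⋯-last) excl) ⟩
    (count Q? N + count R? N) + (indicator (does (Q? (suc N))) + indicator (does (R? (suc N))))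
      ≡⟨ interchange (count Q? N) _ _ _ ⟩
    count Q? (suc N) + count R? (suc N) ∎
    where open ≡-Reasoning

count-single : ∀ {N y} → y ∈[ 1 ⋯ N ] → count (_≟ y) N ≡ 1
count-single {N} {y@(suc y′)} (_ , y≤N) = begin
  count (_≟ y) N
    ≡⟨ count-stable (_≟ y) y≤N (λ y<x _ x≡y → <-irrefl (sym x≡y) y<x) ⟩
  count (_≟ y) y′ + indicator (does (y ≟ y))
    ≡⟨ cong₂ _+_ (count-stable (_≟ y) z≤n (λ _ x≤y′ x≡y → <-irrefl x≡y (s≤s x≤y′)))
                 (cong indicator (dec-true (y ≟ y) refl)) ⟩
  1 ∎
  where open ≡-Reasoning

count-injection : ∀ {P Q : ℕ → Set} (P? : Decidable P) (Q? : Decidable Q) (f : ℕ → ℕ) N {M} →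
  (∀ {x} → x ∈[ 1 ⋯ N ] → P x → f x ∈[ 1 ⋯ M ] × Q (f x)) →
  (∀ {x y} → x ∈[ 1 ⋯ N ] → y ∈[ 1 ⋯ N ] → P x → P y → f x ≡ f y → x ≡ y) →
  count P? N ≤ count Q? M
count-injection P? Q? f zero _ _ = z≤n
count-injection {P} {Q} P? Q? f (suc N) {M} maps inj with P? (suc N)
... | no _ = subst (_≤ count Q? M) (sym (+-identityʳ _))
               (count-injection P? Q? f N (maps ∘ ⋯-weaken) inj′)
  where
  inj′ : ∀ {x y} → x ∈[ 1 ⋯ N ] → y ∈[ 1 ⋯ N ] → P x → P y → f x ≡ f y → x ≡ y
  inj′ x∈ y∈ = inj (⋯-weaken x∈) (⋯-weaken y∈)
... | yes P[1+N] = begin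
  count P? N + 1
    ≤⟨ +-monoˡ-≤ 1 (count-injection P? Q′? f N maps′ inj′) ⟩
  count Q′? M + 1
    ≡⟨ cong (count Q′? M +_) (sym (count-single (proj₁ (maps ⋯-last P[1+N])))) ⟩
  count Q′? M + count (_≟ y₀) M
    ≡⟨ sym (count-split Q? Q′? (_≟ y₀) M (λ _ → Q⇔Q′⊎y₀) (λ ((_ , y≢y₀) , y≡y₀) → y≢y₀ y≡y₀)) ⟩
  count Q? M ∎
  where
  open ≤-Reasoning
  inj′ : ∀ {x y} → x ∈[ 1 ⋯ N ] → y ∈[ 1 ⋯ N ] → P x → P y → f x ≡ f y → x ≡ y
  inj′ x∈ y∈ = inj (⋯-weaken x∈) (⋯-weaken y∈)
  y₀ = f (suc N)
  Q′ : ℕ → Set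
  Q′ y = Q y × y ≢ y₀
  Q′? : Decidable Q′
  Q′? y = Q? y ×-dec ¬? (y ≟ y₀)
  maps′ : ∀ {x} → x ∈[ 1 ⋯ N ] → P x → f x ∈[ 1 ⋯ M ] × Q′ (f x)
  maps′ x∈@(_ , x≤N) Px with maps (⋯-weaken x∈) Px
  ... | fx∈ , Qfx =
    fx∈ , Qfx , λ fx≡y₀ → <-irrefl (inj (⋯-weaken x∈) ⋯-last Px P[1+N] fx≡y₀) (s≤s x≤N)
  Q⇔Q′⊎y₀ : ∀ {y} → Q y ⇔ (Q′ y ⊎ y ≡ y₀)
  Q⇔Q′⊎y₀ {y} = mk⇔ split join
    where
    split : Q y → Q′ y ⊎ y ≡ y₀
    split Qy = ⊎-map (Qy ,_) (λ y≡y₀ → y≡y₀) (swap (toSum (y ≟ y₀)))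
    join : Q′ y ⊎ y ≡ y₀ → Q y
    join (inj₁ (Qy , _)) = Qy
    join (inj₂ refl)     = proj₂ (maps ⋯-last P[1+N])

count-bijection : ∀ {P Q : ℕ → Set} (P? : Decidable P) (Q? : Decidable Q) (f g : ℕ → ℕ) N →
  (∀ {x} → x ∈[ 1 ⋯ N ] → P x → f x ∈[ 1 ⋯ N ] × Q (f x)) →
  (∀ {y} → y ∈[ 1 ⋯ N ] → Q y → g y ∈[ 1 ⋯ N ] × P (g y)) →
  (∀ {x} → x ∈[ 1 ⋯ N ] → P x → g (f x) ≡ x) →
  (∀ {y} → y ∈[ 1 ⋯ N ] → Q y → f (g y) ≡ y) →
  count P? N ≡ count Q? N
count-bijection P? Q? f g N f-maps g-maps g∘f f∘g = ≤-antisym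
  (count-injection P? Q? f N f-maps λ x∈ y∈ Px Py fx≡fy →
     trans (sym (g∘f x∈ Px)) (trans (cong g fx≡fy) (g∘f y∈ Py)))
  (count-injection Q? P? g N g-maps λ x∈ y∈ Qx Qy gx≡gy →
     trans (sym (f∘g x∈ Qx)) (trans (cong f gx≡gy) (f∘g y∈ Qy)))

count-restrict : ∀ {P : ℕ → Set} (P? : Decidable P) {m N} → m ≤ suc N →
                 count (λ x → P? x ×-dec x <? m) N ≡ count P? (m ∸ 1)
count-restrict P? {zero} {N} _ = count-stable (λ x → P? x ×-dec x <? 0) {N = N} z≤n (λ _ _ ())
count-restrict P? {suc m} {N} m<1+N = begin
  count (λ x → P? x ×-dec x <? suc m) N
    ≡⟨ count-stable _ (≤-pred m<1+N) (λ m<x _ (_ , x<1+m) → <⇒≱ m<x (≤-pred x<1+m)) ⟩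
  count (λ x → P? x ×-dec x <? suc m) m
    ≡⟨ count-cong _ P? m (λ (_ , x≤m) → mk⇔ proj₁ (_, s≤s x≤m)) ⟩
  count P? m ∎
  where open ≡-Reasoning

count-< : ∀ {m N} → m ≤ suc N → count (_<? m) N ≡ m ∸ 1
count-< {zero} {N} _ = count-stable (_<? 0) {N = N} z≤n (λ _ _ ())
count-< {suc m} m<1+N =
  trans (count-stable (_<? suc m) (≤-pred m<1+N) (λ m<x _ x<1+m → <⇒≱ m<x (≤-pred x<1+m)))
        (count-all (_<? suc m) m (λ (_ , x≤m) → s≤s x≤m))

module _ {P : ℕ → Set} (P? : Decidable P) where

  private
    none-below-suc : ∀ {k} → (∀ {y} → y < k → ¬ P y) → ¬ P k → ∀ {y} → y < suc k → ¬ P y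
    none-below-suc none ¬Pk y<1+k with m<1+n⇒m<n∨m≡n y<1+k
    ... | inj₁ y<k  = none y<k
    ... | inj₂ refl = ¬Pk

  least-below : ∀ k → (∃[ m ] (P m × ∀ {y} → P y → m ≤ y)) ⊎ (∀ {y} → y < k → ¬ P y)
  least-below zero = inj₂ (λ ())
  least-below (suc k) with least-below k
  ... | inj₁ least = inj₁ least
  ... | inj₂ none with P? k
  ...   | yes Pk = inj₁ (k , Pk , λ Py → ≮⇒≥ (λ y<k → none y<k Py))
  ...   | no ¬Pk = inj₂ (none-below-suc none ¬Pk)

  greatest-below : ∀ k → (∃[ m ] (P m × ∀ {y} → P y → y < k → y ≤ m)) ⊎ (∀ {y} → y < k → ¬ P y)
  greatest-below zero = inj₂ (λ ())
  greatest-below (suc k) with P? k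
  ... | yes Pk = inj₁ (k , Pk , λ _ y<1+k → ≤-pred y<1+k)
  ... | no ¬Pk with greatest-below k
  ...   | inj₂ none = inj₂ (none-below-suc none ¬Pk)
  ...   | inj₁ (m , Pm , greatest) = inj₁ (m , Pm , greatest′)
    where
    greatest′ : ∀ {y} → P y → y < suc k → y ≤ m
    greatest′ Py y<1+k with m<1+n⇒m<n∨m≡n y<1+k
    ... | inj₁ y<k  = greatest Py y<k
    ... | inj₂ refl = contradiction Py ¬Pk

-- Intervals, rank, occurrences and runs

cnt≡count : ∀ {P : ℕ → Set} (P? : Decidable P) N → cnt (λ x → does (P? x)) (interval 1 N) ≡ count P? N
cnt≡count P? zero    = refl
cnt≡count P? (suc N) = begin
  cnt f (map suc (upTo (suc N)))
    ≡⟨ cong (cnt f) (trans (cong (map suc) (sym (upTo-∷ʳ N))) (map-++ suc (upTo N) [ N ])) ⟩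
  cnt f (interval 1 N ++ [ suc N ])
    ≡⟨ cong sum (map-++ _ (interval 1 N) [ suc N ]) ⟩
  sum (map g (interval 1 N) ++ [ g (suc N) ])
    ≡⟨ sum-++ (map g (interval 1 N)) [ g (suc N) ] ⟩
  cnt f (interval 1 N) + (g (suc N) + 0)
    ≡⟨ cong₂ _+_ (cnt≡count P? N) (+-identityʳ _) ⟩
  count P? (suc N) ∎
  where
  open ≡-Reasoning
  f : ℕ → Bool
  f x = does (P? x)
  g : ℕ → ℕ
  g x = indicator (f x)

module _ (L : ℕ → ℕ) (c : ℕ) where

  rank≡count : ∀ i → rank L c i ≡ count (λ j → L j ≟ c) i
  rank≡count = cnt≡count (λ j → L j ≟ c)

  rank-suc : ∀ k → rank L c (suc k) ≡ rank L c k + indicator (L (suc k) ≡ᵇ c)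
  rank-suc k = trans (rank≡count (suc k)) (cong (_+ indicator (L (suc k) ≡ᵇ c)) (sym (rank≡count k)))

  rank-before : ∀ {s} → 1 ≤ s → rank L c s ∸ indicator (L s ≡ᵇ c) ≡ rank L c (s ∸ 1)
  rank-before {suc k} _ = trans (cong (_∸ indicator (L (suc k) ≡ᵇ c)) (rank-suc k))
                                (m+n∸n≡m (rank L c k) (indicator (L (suc k) ≡ᵇ c)))

  rank-mono : ∀ {k k′} → k ≤ k′ → rank L c k ≤ rank L c k′
  rank-mono {k} {k′} k≤k′ =
    subst₂ _≤_ (sym (rank≡count k)) (sym (rank≡count k′)) (count-mono _ k≤k′)

  rank-stable : ∀ {k k′} → k ≤ k′ → (∀ {x} → k < x → x ≤ k′ → L x ≢ c) →
                rank L c k′ ≡ rank L c k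
  rank-stable {k} {k′} k≤k′ none =
    trans (rank≡count k′) (trans (count-stable _ k≤k′ none) (sym (rank≡count k)))

below-interval-end : ∀ {i j k} → i ≤ k → k < i + (suc j ∸ i) → k ≤ j
below-interval-end {i} {j} {k} i≤k k<end with i ≤? suc j
... | yes i≤1+j = ≤-pred (subst (k <_) (m+[n∸m]≡n i≤1+j) k<end)
... | no  i≰1+j = contradiction (subst (k <_) end≡i k<end) (≤⇒≯ i≤k)
  where
  end≡i : i + (suc j ∸ i) ≡ i
  end≡i = trans (cong (i +_) (m≤n⇒m∸n≡0 (<⇒≤ (≰⇒> i≰1+j)))) (+-identityʳ i)

∈-interval⁻ : ∀ {i j x} → x ∈ interval i j → x ∈[ i ⋯ j ]
∈-interval⁻ {i} x∈ with ∈-map⁻ (i +_) x∈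
... | d , d∈ , refl = m≤m+n i d , below-interval-end (m≤m+n i d) (+-monoʳ-< i (∈-upTo⁻ d∈))

∈-interval⁺ : ∀ {i j x} → x ∈[ i ⋯ j ] → x ∈ interval i j
∈-interval⁺ {i} {j} (i≤x , x≤j) =
  subst (_∈ interval i j) (m+[n∸m]≡n i≤x) (∈-map⁺ (i +_) (∈-upTo⁺ (∸-monoˡ-< (s≤s x≤j) i≤x)))

map-+-upTo-suc : ∀ i d → map (i +_) (upTo (suc d)) ≡ i ∷ map (suc i +_) (upTo d)
map-+-upTo-suc i d = cong₂ _∷_ (+-identityʳ i) (begin
  map (i +_) (applyUpTo suc d)   ≡⟨ cong (map (i +_)) (sym (map-upTo suc d)) ⟩
  map (i +_) (map suc (upTo d))  ≡⟨ sym (map-∘ (upTo d)) ⟩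
  map (λ k → i + suc k) (upTo d) ≡⟨ map-cong (+-suc i) (upTo d) ⟩
  map (suc i +_) (upTo d)        ∎)
  where open ≡-Reasoning

occursB-sound : ∀ {L c i j} → T (occursB L c i j) → ∃[ x ] (x ∈[ i ⋯ j ] × L x ≡ c)
occursB-sound {L} {c} occ with find (any⁻ (λ k → L k ≡ᵇ c) _ occ)
... | x , x∈ , Lx≡ᵇc = x , ∈-interval⁻ x∈ , ≡ᵇ⇒≡ (L x) c Lx≡ᵇc

occursB-complete : ∀ {L c i j x} → x ∈[ i ⋯ j ] → L x ≡ c → T (occursB L c i j)
occursB-complete {L} {c} x∈ Lx≡c =
  any⁺ (λ k → L k ≡ᵇ c) (lose (∈-interval⁺ x∈) (≡⇒≡ᵇ (L _) c Lx≡c))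

firstOcc-∷ : ∀ L c x xs {k} → firstOcc L c (x ∷ xs) ≡ just k →
             (L x ≡ c × x ≡ k) ⊎ (L x ≢ c × firstOcc L c xs ≡ just k)
firstOcc-∷ L c x xs found with L x ≡ᵇ c in Lx≡ᵇc
... | true  = inj₁ (≡ᵇ⇒≡ (L x) c (subst T (sym Lx≡ᵇc) _) , just-injective found)
... | false = inj₂ ((λ Lx≡c → subst T Lx≡ᵇc (≡⇒≡ᵇ (L x) c Lx≡c)) , found)

firstOcc-nothing : ∀ L c xs → firstOcc L c xs ≡ nothing → ∀ {y} → y ∈ xs → L y ≢ c
firstOcc-nothing L c (x ∷ xs) none y∈ Ly≡c with L x ≡ᵇ c in Lx≡ᵇc | y∈
... | false | here refl  = subst T Lx≡ᵇc (≡⇒≡ᵇ (L x) c Ly≡c)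
... | false | there y∈xs = firstOcc-nothing L c xs none y∈xs Ly≡c

firstOcc-found : ∀ L c {xs x} → x ∈ xs → L x ≡ c → ∃[ k ] (firstOcc L c xs ≡ just k)
firstOcc-found L c {xs} x∈ Lx≡c with firstOcc L c xs in found
... | just k  = k , refl
... | nothing = contradiction Lx≡c (firstOcc-nothing L c xs found x∈)

firstOcc-shifted : ∀ L c i d {k} → firstOcc L c (map (i +_) (upTo d)) ≡ just k →
                   i ≤ k × k < i + d × L k ≡ c × (∀ {y} → i ≤ y → y < k → L y ≢ c)
firstOcc-shifted L c i (suc d) {k} found
  with firstOcc-∷ L c i (map (suc i +_) (upTo d))
                 (subst (λ xs → firstOcc L c xs ≡ just k) (map-+-upTo-suc i d) found)
... | inj₁ (Li≡c , refl) = ≤-refl , m<m+n i z<s , Li≡c , λ i≤y y<i → contradiction y<i (≤⇒≯ i≤y)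
... | inj₂ (Li≢c , found′) with firstOcc-shifted L c (suc i) d found′
...   | i<k , k<end , Lk≡c , none = <⇒≤ i<k , subst (k <_) (sym (+-suc i d)) k<end , Lk≡c , none′
  where
  none′ : ∀ {y} → i ≤ y → y < k → L y ≢ c
  none′ i≤y y<k with m≤n⇒m<n∨m≡n i≤y
  ... | inj₁ i<y  = none i<y y<k
  ... | inj₂ refl = Li≢c

firstOcc-interval : ∀ L c i j {k} → firstOcc L c (interval i j) ≡ just k →
                    k ∈[ i ⋯ j ] × L k ≡ c × (∀ {y} → i ≤ y → y < k → L y ≢ c)
firstOcc-interval L c i j found with firstOcc-shifted L c i (suc j ∸ i) found
... | i≤k , k<end , Lk≡c , none = (i≤k , below-interval-end i≤k k<end) , Lk≡c , none

<⇒≤∸1 : ∀ {x j} → x < j → x ≤ j ∸ 1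
<⇒≤∸1 {j = suc j} (s≤s x≤j) = x≤j

≤∸1⇒< : ∀ {x j} → 1 ≤ j → x ≤ j ∸ 1 → x < j
≤∸1⇒< {j = suc j} _ x≤j = s≤s x≤j

∸1<⇒≤ : ∀ {s x} → 1 ≤ s → s ∸ 1 < x → s ≤ x
∸1<⇒≤ {suc s} _ s<x = s<x

runHead-start : ∀ (L : ℕ → ℕ) {j} → 2 ≤ j → L (j ∸ 1) ≢ L j → runHead L j ≡ j
runHead-start L {suc zero}    (s≤s ())
runHead-start L {suc (suc k)} _ change = if-cong (dec-false (L (suc k) ≟ L (suc (suc k))) change)

module _ {n : ℕ} {S SA : ℕ → ℕ} (O : Oracle) {c sp ep o r : ℕ} where

  bwStep-extend : ∀ {t} → Oracle.hr O c sp ≡ (o , true) → Oracle.rk O c ep ≡ r →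
    bwStep n S SA O c (sp , ep , just t) ≡
      just (Ccount n S c + (o ∸ 1) + 1 , Ccount n S c + r , just (t ∸ 1))
  bwStep-extend hr≡ rk≡ rewrite hr≡ | rk≡ = refl

  bwStep-relocate : ∀ {β t j} → Oracle.hr O c sp ≡ (o , β) → Oracle.rk O c ep ≡ r →
    Oracle.sc O c sp ≡ just j → β ≡ false ⊎ t ≡ nothing →
    bwStep n S SA O c (sp , ep , t) ≡
      just (Ccount n S c + (o ∸ indicator β) + 1 , Ccount n S c + r , just (SA (runHead (BWT S SA) j) ∸ 1))
  bwStep-relocate         hr≡ rk≡ sc≡ (inj₁ refl) rewrite hr≡ | sc≡ | rk≡ = refl
  bwStep-relocate {false} hr≡ rk≡ sc≡ (inj₂ refl) rewrite hr≡ | sc≡ | rk≡ = refl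
  bwStep-relocate {true}  hr≡ rk≡ sc≡ (inj₂ refl) rewrite hr≡ | sc≡ | rk≡ = refl

-- The guard under which sampledOracle routes a query at i through u₂.Z[c].
routing-off : ∀ {p i q} {o k : Bool} → (p ≤ i → i ≤ q → T o ⊎ T k) →
              (((p ≤ᵇ i) ∧ (i ≤ᵇ q)) ∧ (not o ∧ not k)) ≡ false
routing-off {p} {i} {q} {o} {k} kept =
  guard (p ≤ᵇ i) (i ≤ᵇ q) o k λ p≤i i≤q → kept (≤ᵇ⇒≤ p i p≤i) (≤ᵇ⇒≤ i q i≤q)
  where
  guard : ∀ a b o k → (T a → T b → T o ⊎ T k) → ((a ∧ b) ∧ (not o ∧ not k)) ≡ false
  guard false _     _     _     _    = refl
  guard true  false _     _     _    = refl
  guard true  true  true  _     _    = refl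
  guard true  true  false true  _    = refl
  guard true  true  false false kept′ with kept′ _ _
  ... | inj₁ ()
  ... | inj₂ ()

module SampledOracle (n : ℕ) (L : ℕ → ℕ) (p q : ℕ) (K : ℕ → Bool) {c i : ℕ} where

  private
    O : Oracle
    O = sampledOracle n L p q K

  sampled-rk : (p ≤ i → i ≤ q → T (occursB L c p q) ⊎ T (K c)) → Oracle.rk O c i ≡ rank L c i
  sampled-rk kept = if-cong (routing-off kept)

  sampled-hr : (p ≤ i → i ≤ q → T (occursB L c p q) ⊎ T (K c)) →
               Oracle.hr O c i ≡ (rank L c i , (L i ≡ᵇ c))
  sampled-hr kept = if-cong (routing-off kept)

  sampled-sc : (p ≤ i → i ≤ q → T (occursB L c i q) ⊎ T (K c)) → Oracle.sc O c i ≡ succL n L c i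
  sampled-sc kept = if-cong (routing-off kept)

-- Suffix arrays and the LF-mapping

_<ₗ_ : List ℕ → List ℕ → Set
_<ₗ_ = Lex-< _≡_ _<_

<ₗ-irrefl : ∀ {xs} → ¬ xs <ₗ xs
<ₗ-irrefl = <-irreflexive <-irrefl (pointwise-refl refl)

<ₗ-asym : ∀ {xs ys} → xs <ₗ ys → ¬ ys <ₗ xs
<ₗ-asym = <-asymmetric sym (resp₂ _<_) <-asym

∷-<ₗ-∷ : ∀ {a b as bs} → (a ∷ as) <ₗ (b ∷ bs) ⇔ (a < b ⊎ (a ≡ b × as <ₗ bs))
∷-<ₗ-∷ = mk⇔ to from
  where
  to : ∀ {a b as bs} → (a ∷ as) <ₗ (b ∷ bs) → a < b ⊎ (a ≡ b × as <ₗ bs)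
  to (this a<b)        = inj₁ a<b
  to (next a≡b as<bs) = inj₂ (a≡b , as<bs)
  from : ∀ {a b as bs} → a < b ⊎ (a ≡ b × as <ₗ bs) → (a ∷ as) <ₗ (b ∷ bs)
  from (inj₁ a<b)            = this a<b
  from (inj₂ (a≡b , as<bs)) = next a≡b as<bs

module SuffixArrays (n σ : ℕ) (S SA : ℕ → ℕ) (text : IsText n σ S) (sa : IsSuffixArray n S SA) where

  L : ℕ → ℕ
  L = BWT S SA

  C : ℕ → ℕ
  C = Ccount n S

  suf : ℕ → List ℕ
  suf = suffix n S

  C≡count : ∀ c → C c ≡ count (λ k → S k <? c) n
  C≡count c = cnt≡count (λ k → S k <? c) n

  symbol-before-end : ∀ {k} → k ≤ n → 1 ≤ S k → k < n
  symbol-before-end {k} k≤n 1≤Sk with m≤n⇒m<n∨m≡n k≤n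
  ... | inj₁ k<n  = k<n
  ... | inj₂ refl = contradiction (proj₁ (proj₂ text)) λ Sn≡0 → <-irrefl (sym Sn≡0) 1≤Sk

  suf-cons : ∀ {k} → k ≤ n → suf k ≡ S k ∷ suf (suc k)
  suf-cons {k} k≤n = cong (map S)
    (trans (cong (λ d → map (k +_) (upTo d)) (+-∸-assoc 1 k≤n)) (map-+-upTo-suc k (n ∸ k)))

  SA-row : ∀ {x} → x ∈[ 1 ⋯ n ] → SA x ∈[ 1 ⋯ n ]
  SA-row (1≤x , x≤n) = proj₁ sa _ 1≤x x≤n

  rows-ordered : ∀ {x y} → x ∈[ 1 ⋯ n ] → y ∈[ 1 ⋯ n ] → x < y ⇔ suf (SA x) <ₗ suf (SA y)
  rows-ordered {x} {y} (1≤x , x≤n) (1≤y , y≤n) = mk⇔ (λ x<y → proj₂ sa x y 1≤x x<y y≤n) from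
    where
    from : suf (SA x) <ₗ suf (SA y) → x < y
    from x≺y with <-cmp x y
    ... | tri< x<y _ _  = x<y
    ... | tri≈ _ refl _ = contradiction x≺y <ₗ-irrefl
    ... | tri> _ _ y<x  = contradiction (proj₂ sa y x 1≤y y<x x≤n) (<ₗ-asym x≺y)

  SA-injective : ∀ {x y} → x ∈[ 1 ⋯ n ] → y ∈[ 1 ⋯ n ] → SA x ≡ SA y → x ≡ y
  SA-injective {x} {y} x∈ y∈ SAx≡SAy with <-cmp x y
  ... | tri< x<y _ _ = contradiction (subst (λ k → suf (SA x) <ₗ suf k) (sym SAx≡SAy)
                                       (Equivalence.to (rows-ordered x∈ y∈) x<y)) <ₗ-irrefl
  ... | tri≈ _ x≡y _ = x≡y
  ... | tri> _ _ y<x = contradiction (subst (λ k → suf (SA y) <ₗ suf k) SAx≡SAy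
                                       (Equivalence.to (rows-ordered y∈ x∈) y<x)) <ₗ-irrefl

  SA-hits : ∀ {i} → i ∈[ 1 ⋯ n ] → ¬ (∀ {x} → x ∈[ 1 ⋯ n ] → SA x ≢ i)
  SA-hits {i} i∈ missed = <-irrefl refl (begin-strict
    count others n       <⟨ n<1+n _ ⟩
    suc (count others n) ≡⟨ +-comm 1 _ ⟩
    count others n + 1   ≡⟨ sym total ⟩
    count every n        ≤⟨ count-injection every others SA n (λ x∈ _ → SA-row x∈ , missed x∈)
                                                              (λ x∈ y∈ _ _ → SA-injective x∈ y∈) ⟩
    count others n       ∎)
    where
    open ≤-Reasoning
    every : Decidable (λ _ → ⊤)
    every _ = yes tt
    others : Decidable (_≢ i)
    others y = ¬? (y ≟ i)
    total : count every n ≡ count others n + 1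
    total = trans (count-split every others (_≟ i) n (λ {y} _ → mk⇔ (λ _ → swap (toSum (y ≟ i))) _)
                                                      (λ (y≢i , y≡i) → y≢i y≡i))
                  (cong (count others n +_) (count-single i∈))

  isa : ℕ → ℕ
  isa i = fromMaybe 0 (firstOcc SA i (interval 1 n))

  isa-row : ∀ {i} → i ∈[ 1 ⋯ n ] → isa i ∈[ 1 ⋯ n ] × SA (isa i) ≡ i
  isa-row {i} i∈ = from-search (firstOcc SA i (interval 1 n)) refl
    where
    from-search : ∀ m → firstOcc SA i (interval 1 n) ≡ m →
                  fromMaybe 0 m ∈[ 1 ⋯ n ] × SA (fromMaybe 0 m) ≡ i
    from-search (just x) found with firstOcc-interval SA i 1 n found
    ... | x∈ , SAx≡i , _ = x∈ , SAx≡i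
    from-search nothing  none  =
      contradiction (λ {x} x∈ → firstOcc-nothing SA i (interval 1 n) none (∈-interval⁺ x∈)) (SA-hits i∈)

  SA-isa : ∀ {i} → i ∈[ 1 ⋯ n ] → SA (isa i) ≡ i
  SA-isa i∈ = proj₂ (isa-row i∈)

  isa-SA : ∀ {x} → x ∈[ 1 ⋯ n ] → isa (SA x) ≡ x
  isa-SA x∈ = SA-injective (proj₁ (isa-row (SA-row x∈))) x∈ (SA-isa (SA-row x∈))

  isa-ordered : ∀ {k i} → k ∈[ 1 ⋯ n ] → i ∈[ 1 ⋯ n ] → isa k < isa i ⇔ suf k <ₗ suf i
  isa-ordered k∈ i∈ = subst₂ (λ a b → isa _ < isa _ ⇔ suf a <ₗ suf b) (SA-isa k∈) (SA-isa i∈)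
                             (rows-ordered (proj₁ (isa-row k∈)) (proj₁ (isa-row i∈)))

  L-SA : ∀ {y k} → SA y ≡ suc k → 1 ≤ k → L y ≡ S k
  L-SA {y} {suc k} SAy≡ _ rewrite SAy≡ = refl

  L-symbol : ∀ {y} → y ∈[ 1 ⋯ n ] → 1 ≤ L y → ∃[ k ] (SA y ≡ suc k × 1 ≤ k × k < n × S k ≡ L y)
  L-symbol {y} y∈ 1≤Ly with SA y | SA-row y∈
  ... | suc zero    | _           = contradiction 1≤Ly λ ()
  ... | suc (suc k) | (_ , 2+k≤n) = suc k , refl , s≤s z≤n , 2+k≤n , refl

  LF : ℕ → ℕ → ℕ
  LF c y = C c + rank L c (y ∸ 1) + 1

  -- The suffixes below suffix i are those starting with a smaller symbol, plus those starting
  -- with c = S i whose tail is below suffix i+1; the latter correspond to the occurrences of c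
  -- in L above row isa (i+1).
  private
    module Ranking {i} (1≤i : 1 ≤ i) (i<n : i < n) where
      c = S i
      r = isa i
      r′ = isa (suc i)

      i∈ : i ∈[ 1 ⋯ n ]
      i∈ = 1≤i , <⇒≤ i<n

      1+i∈ : suc i ∈[ 1 ⋯ n ]
      1+i∈ = s≤s z≤n , i<n

      1≤c : 1 ≤ c
      1≤c = proj₁ (proj₂ (proj₂ text) i 1≤i i<n)

      r∈ : r ∈[ 1 ⋯ n ]
      r∈ = proj₁ (isa-row i∈)

      r′∈ : r′ ∈[ 1 ⋯ n ]
      r′∈ = proj₁ (isa-row 1+i∈)

      successor∈ : ∀ {k} → k ∈[ 1 ⋯ n ] → S k ≡ c → suc k ∈[ 1 ⋯ n ]
      successor∈ (_ , k≤n) Sk≡c = s≤s z≤n , symbol-before-end k≤n (subst (1 ≤_) (sym Sk≡c) 1≤c)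

      precedes⇔ : ∀ {k} → k ∈[ 1 ⋯ n ] → isa k < r ⇔ (S k < c ⊎ (S k ≡ c × isa (suc k) < r′))
      precedes⇔ {k} k∈@(_ , k≤n) = mk⇔ to from
        where
        by-suffix : isa k < r ⇔ (S k ∷ suf (suc k)) <ₗ (c ∷ suf (suc i))
        by-suffix = subst₂ (λ a b → isa k < r ⇔ a <ₗ b) (suf-cons k≤n) (suf-cons (<⇒≤ i<n))
                           (isa-ordered k∈ i∈)
        to : isa k < r → S k < c ⊎ (S k ≡ c × isa (suc k) < r′)
        to k<r with Equivalence.to ∷-<ₗ-∷ (Equivalence.to by-suffix k<r)
        ... | inj₁ Sk<c            = inj₁ Sk<c
        ... | inj₂ (Sk≡c , tail<) =
          inj₂ (Sk≡c , Equivalence.from (isa-ordered (successor∈ k∈ Sk≡c) 1+i∈) tail<)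
        from : S k < c ⊎ (S k ≡ c × isa (suc k) < r′) → isa k < r
        from (inj₁ Sk<c)            = Equivalence.from by-suffix (this Sk<c)
        from (inj₂ (Sk≡c , tail<)) = Equivalence.from by-suffix
          (next Sk≡c (Equivalence.to (isa-ordered (successor∈ k∈ Sk≡c) 1+i∈) tail<))

      rows-above : count (_<? r) n ≡ count (λ k → isa k <? r) n
      rows-above = count-bijection (_<? r) (λ k → isa k <? r) SA isa n
        (λ x∈ x<r → SA-row x∈ , subst (_< r) (sym (isa-SA x∈)) x<r)
        (λ k∈ isak<r → proj₁ (isa-row k∈) , isak<r)
        (λ x∈ _ → isa-SA x∈)
        (λ k∈ _ → SA-isa k∈)

      equal-heads : count (λ k → S k ≟ c ×-dec isa (suc k) <? r′) n ≡
                    count (λ y → L y ≟ c ×-dec y <? r′) n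
      equal-heads = count-bijection _ _ (isa ∘ suc) (λ y → SA y ∸ 1) n forward backward
        (λ k∈ (Sk≡c , _) → cong (_∸ 1) (SA-isa (successor∈ k∈ Sk≡c)))
        (λ y∈ (Ly≡c , _) → isa-suc-pred y∈ Ly≡c)
        where
        isa-suc-pred : ∀ {y} → y ∈[ 1 ⋯ n ] → L y ≡ c → isa (suc (SA y ∸ 1)) ≡ y
        isa-suc-pred y∈ Ly≡c with L-symbol y∈ (subst (1 ≤_) (sym Ly≡c) 1≤c)
        ... | _ , SAy≡ , _ =
          trans (cong (isa ∘ suc ∘ (_∸ 1)) SAy≡) (trans (cong isa (sym SAy≡)) (isa-SA y∈))
        forward : ∀ {k} → k ∈[ 1 ⋯ n ] → S k ≡ c × isa (suc k) < r′ →
                  isa (suc k) ∈[ 1 ⋯ n ] × (L (isa (suc k)) ≡ c × isa (suc k) < r′)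
        forward k∈@(1≤k , _) (Sk≡c , above) =
          proj₁ (isa-row (successor∈ k∈ Sk≡c)) ,
          trans (L-SA (SA-isa (successor∈ k∈ Sk≡c)) 1≤k) Sk≡c , above
        backward : ∀ {y} → y ∈[ 1 ⋯ n ] → L y ≡ c × y < r′ →
                   (SA y ∸ 1) ∈[ 1 ⋯ n ] × (S (SA y ∸ 1) ≡ c × isa (suc (SA y ∸ 1)) < r′)
        backward y∈ (Ly≡c , above) with L-symbol y∈ (subst (1 ≤_) (sym Ly≡c) 1≤c)
        ... | k , SAy≡ , 1≤k , k<n , Sk≡Ly rewrite SAy≡ =
          (1≤k , <⇒≤ k<n) , trans Sk≡Ly Ly≡c ,
          subst (_< r′) (sym (trans (cong isa (sym SAy≡)) (isa-SA y∈))) above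

      rows-before : r ∸ 1 ≡ C c + rank L c (r′ ∸ 1)
      rows-before = begin
        r ∸ 1
          ≡⟨ sym (count-< (m≤n⇒m≤1+n (proj₂ r∈))) ⟩
        count (_<? r) n
          ≡⟨ rows-above ⟩
        count (λ k → isa k <? r) n
          ≡⟨ count-split _ _ _ n precedes⇔ (λ (Sk<c , Sk≡c , _) → <-irrefl Sk≡c Sk<c) ⟩
        count (λ k → S k <? c) n + count (λ k → S k ≟ c ×-dec isa (suc k) <? r′) n
          ≡⟨ cong₂ _+_ (sym (C≡count c)) equal-heads ⟩
        C c + count (λ y → L y ≟ c ×-dec y <? r′) n
          ≡⟨ cong (C c +_) (count-restrict (λ y → L y ≟ c) (m≤n⇒m≤1+n (proj₂ r′∈))) ⟩
        C c + count (λ y → L y ≟ c) (r′ ∸ 1)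
          ≡⟨ cong (C c +_) (sym (rank≡count L c (r′ ∸ 1))) ⟩
        C c + rank L c (r′ ∸ 1) ∎
        where open ≡-Reasoning

  isa-LF : ∀ {i} → 1 ≤ i → i < n → isa i ≡ LF (S i) (isa (suc i))
  isa-LF 1≤i i<n = trans (sym (m∸n+n≡m (proj₁ r∈))) (cong (_+ 1) rows-before)
    where open Ranking 1≤i i<n

  LF-row : ∀ {y c} → y ∈[ 1 ⋯ n ] → 1 ≤ c → L y ≡ c →
           LF c y ∈[ 1 ⋯ n ] × SA (LF c y) ≡ SA y ∸ 1
  LF-row {y} {c} y∈ 1≤c Ly≡c with L-symbol y∈ (subst (1 ≤_) (sym Ly≡c) 1≤c)
  ... | k , SAy≡ , 1≤k , k<n , Sk≡Ly =
    subst (λ x → x ∈[ 1 ⋯ n ] × SA x ≡ SA y ∸ 1) isa-k≡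
          (proj₁ (isa-row k∈) , trans (SA-isa k∈) (cong (_∸ 1) (sym SAy≡)))
    where
    k∈ : k ∈[ 1 ⋯ n ]
    k∈ = 1≤k , <⇒≤ k<n
    isa-k≡ : isa k ≡ LF c y
    isa-k≡ = trans (isa-LF 1≤k k<n)
                   (cong₂ LF (trans Sk≡Ly Ly≡c) (trans (cong isa (sym SAy≡)) (isa-SA y∈)))

  LF-mono : ∀ c {y y′} → y ≤ y′ → LF c y ≤ LF c y′
  LF-mono c y≤y′ = +-monoˡ-≤ 1 (+-monoʳ-≤ (C c) (rank-mono L c (∸-monoˡ-≤ 1 y≤y′)))

  LF-occurrence : ∀ {y c} → 1 ≤ y → L y ≡ c → LF c y ≡ C c + rank L c y
  LF-occurrence {suc y} {c} _ Ly≡c = begin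
    C c + rank L c y + 1
      ≡⟨ +-assoc (C c) _ 1 ⟩
    C c + (rank L c y + 1)
      ≡⟨ cong (λ b → C c + (rank L c y + indicator b)) (sym (dec-true (L (suc y) ≟ c) Ly≡c)) ⟩
    C c + (rank L c y + indicator (L (suc y) ≡ᵇ c))
      ≡⟨ cong (C c +_) (sym (rank-suc L c y)) ⟩
    C c + rank L c (suc y) ∎
    where open ≡-Reasoning

  LF-bounded : ∀ {c k} → 1 ≤ c → k ≤ n → C c + rank L c k ≤ n
  LF-bounded {c} {zero} _ _ = subst (_≤ n) (sym (trans (+-identityʳ (C c)) (C≡count c))) (count-≤ _ n)
  LF-bounded {c} {suc k} 1≤c 1+k≤n with L (suc k) ≟ c
  ... | yes L≡c = subst (_≤ n) (LF-occurrence (s≤s z≤n) L≡c)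
                         (proj₂ (proj₁ (LF-row (s≤s z≤n , 1+k≤n) 1≤c L≡c)))
  ... | no  L≢c = subst (λ r → C c + r ≤ n) (sym (rank-stable L c (n≤1+n k) only-last))
                         (LF-bounded 1≤c (<⇒≤ 1+k≤n))
    where
    only-last : ∀ {x} → k < x → x ≤ suc k → L x ≢ c
    only-last k<x x≤1+k = subst (λ x → L x ≢ c) (≤-antisym k<x x≤1+k) L≢c

module BackwardSearch (n σ : ℕ) (S SA : ℕ → ℕ) (text : IsText n σ S) (sa : IsSuffixArray n S SA) where
  open SuffixArrays n σ S SA text sa

  sp ep : List ℕ → ℕ
  sp P = proj₁ (bsRange n S SA P)
  ep P = proj₂ (bsRange n S SA P)

  sp-positive : ∀ P → 1 ≤ sp P
  sp-positive []      = s≤s z≤n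
  sp-positive (c ∷ P) = subst (1 ≤_) (+-comm 1 _) (s≤s z≤n)

  ep-bounded : ∀ {P} → IsPattern σ P → ep P ≤ n
  ep-bounded []                  = ≤-refl
  ep-bounded ((1≤c , _) ∷ pat) = LF-bounded 1≤c (ep-bounded pat)

  _occursAt_ : List ℕ → ℕ → Set
  []      occursAt i = ⊤
  (c ∷ P) occursAt i = S i ≡ c × P occursAt suc i

  factor : ℕ → ℕ → List ℕ
  factor i len = map (λ k → S (i + k)) (upTo len)

  factor-suc : ∀ i len → factor i (suc len) ≡ S i ∷ factor (suc i) len
  factor-suc i len = begin
    map (S ∘ (i +_)) (upTo (suc len))        ≡⟨ map-∘ (upTo (suc len)) ⟩
    map S (map (i +_) (upTo (suc len)))      ≡⟨ cong (map S) (map-+-upTo-suc i len) ⟩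
    S i ∷ map S (map (suc i +_) (upTo len))  ≡⟨ cong (S i ∷_) (sym (map-∘ (upTo len))) ⟩
    S i ∷ factor (suc i) len                 ∎
    where open ≡-Reasoning

  length-factor : ∀ i len → length (factor i len) ≡ len
  length-factor i len = trans (length-map _ (upTo len)) (length-upTo len)

  occursAt-factor : ∀ P i → factor i (length P) ≡ P → P occursAt i
  occursAt-factor []      i _  = tt
  occursAt-factor (c ∷ P) i eq with ∷-injective (trans (sym (factor-suc i (length P))) eq)
  ... | Si≡c , rest = Si≡c , occursAt-factor P (suc i) rest

  Occurs-tail : ∀ {c P} → Occurs n S (c ∷ P) → Occurs n S P
  Occurs-tail {c} {P} (i , _ , bound , eq) =
    suc i , s≤s z≤n , subst (_≤ suc n) (+-suc i (length P)) bound ,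
    proj₂ (∷-injective (trans (sym (factor-suc i (length P))) eq))

  occurrence-in-range : ∀ {P x} → IsPattern σ P → x ∈[ 1 ⋯ n ] → P occursAt SA x →
                        x ∈[ sp P ⋯ ep P ]
  occurrence-in-range {[]}    _                  x∈ _ = x∈
  occurrence-in-range {c ∷ P} {x} ((1≤c , _) ∷ pat) x∈ (Sk≡c , rest) = lower , upper
    where
    k = SA x
    1≤k = proj₁ (SA-row x∈)
    k<n : k < n
    k<n = symbol-before-end (proj₂ (SA-row x∈)) (subst (1 ≤_) (sym Sk≡c) 1≤c)
    1+k∈ : suc k ∈[ 1 ⋯ n ]
    1+k∈ = s≤s z≤n , k<n
    x′ = isa (suc k)
    x′∈ = proj₁ (isa-row 1+k∈)
    x′-range : x′ ∈[ sp P ⋯ ep P ]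
    x′-range = occurrence-in-range pat x′∈ (subst (P occursAt_) (sym (SA-isa 1+k∈)) rest)
    x≡ : x ≡ LF c x′
    x≡ = trans (sym (isa-SA x∈)) (trans (isa-LF 1≤k k<n) (cong (λ d → LF d x′) Sk≡c))
    lower : LF c (sp P) ≤ x
    lower = subst (LF c (sp P) ≤_) (sym x≡) (LF-mono c (proj₁ x′-range))
    upper : x ≤ C c + rank L c (ep P)
    upper = subst (_≤ C c + rank L c (ep P))
              (sym (trans x≡ (LF-occurrence (proj₁ x′∈) (trans (L-SA (SA-isa 1+k∈) 1≤k) Sk≡c))))
              (+-monoʳ-≤ (C c) (rank-mono L c (proj₂ x′-range)))

  symbol-in-range : ∀ {c P} → IsPattern σ (c ∷ P) → Occurs n S (c ∷ P) →
                    ∃[ j ] (j ∈[ sp P ⋯ ep P ] × L j ≡ c)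
  symbol-in-range {c} {P} ((1≤c , _) ∷ pat) (i , 1≤i , bound , eq) with occursAt-factor (c ∷ P) i eq
  ... | Si≡c , rest =
    isa (suc i) ,
    occurrence-in-range pat (proj₁ (isa-row 1+i∈)) (subst (P occursAt_) (sym (SA-isa 1+i∈)) rest) ,
    trans (L-SA (SA-isa 1+i∈) 1≤i) Si≡c
    where
    i≤n : i ≤ n
    i≤n = m+n≤o⇒m≤o i (≤-pred (subst (_≤ suc n) (+-suc i (length P)) bound))
    1+i∈ : suc i ∈[ 1 ⋯ n ]
    1+i∈ = s≤s z≤n , symbol-before-end i≤n (subst (1 ≤_) (sym Si≡c) 1≤c)

  FactorRange : ℕ → ℕ → ℕ → ℕ → Set
  FactorRange s e i len =
    1 ≤ i × i + len ≤ suc n × IsPattern σ (factor i len) × bsRange n S SA (factor i len) ≡ (s , e)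

  InRanges? : ∀ s e → Dec (InRanges n σ S SA s e)
  InRanges? s e = map′ from to (anyUpTo? (λ i → anyUpTo? (FactorRange? i) (2 + n)) (2 + n))
    where
    FactorRange? : ∀ i len → Dec (FactorRange s e i len)
    FactorRange? i len = 1 ≤? i ×-dec i + len ≤? suc n
                         ×-dec all? (λ x → 1 ≤? x ×-dec x ≤? σ) (factor i len)
                         ×-dec ≡-dec _≟_ _≟_ (bsRange n S SA (factor i len)) (s , e)
    to : InRanges n σ S SA s e → ∃[ i ] (i < 2 + n × ∃[ len ] (len < 2 + n × FactorRange s e i len))
    to (Q , pat , (i , 1≤i , bound , eq) , range) =
      i , s≤s (m+n≤o⇒m≤o i bound) , length Q , s≤s (m+n≤o⇒n≤o i bound) ,
      1≤i , bound , subst (IsPattern σ) (sym eq) pat , trans (cong (bsRange n S SA) eq) range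
    from : ∃[ i ] (i < 2 + n × ∃[ len ] (len < 2 + n × FactorRange s e i len)) → InRanges n σ S SA s e
    from (i , _ , len , _ , 1≤i , bound , pat , range) =
      factor i len , pat ,
      (i , 1≤i , subst (λ m → i + m ≤ suc n) (sym (length-factor i len)) bound ,
       cong (factor i) (length-factor i len)) ,
      range

  toehold : List ℕ → Maybe ℕ
  toehold []      = nothing
  toehold (c ∷ P) = just (SA (sp (c ∷ P)))

  module Step (O : Oracle) {c P} (pat : IsPattern σ (c ∷ P)) (occ : Occurs n S (c ∷ P))
              (hr≡ : Oracle.hr O c (sp P) ≡ (rank L c (sp P) , (L (sp P) ≡ᵇ c)))
              (rk≡ : Oracle.rk O c (ep P) ≡ rank L c (ep P))
              (sc≡ : Oracle.sc O c (sp P) ≡ succL n L c (sp P)) where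

    private
      s = sp P
      e = ep P
      1≤s = sp-positive P
      1≤c = proj₁ (All-head pat)

      witness = symbol-in-range pat occ
      s≤j₀ = proj₁ (proj₁ (proj₂ witness))
      j₀≤n = ≤-trans (proj₂ (proj₁ (proj₂ witness))) (ep-bounded (All-tail pat))
      Lj₀≡c = proj₂ (proj₂ witness)

      result≡ : ∀ {u t} → u ≡ rank L c (s ∸ 1) → t ≡ SA (LF c s) →
                just {A = ℕ × ℕ × Maybe ℕ} (C c + u + 1 , C c + rank L c e , just t) ≡
                just (sp (c ∷ P) , ep (c ∷ P) , toehold (c ∷ P))
      result≡ refl refl = refl

    extend : L s ≡ c → ∀ {t} → t ≡ just (SA s) →
             bwStep n S SA O c (s , e , t) ≡ just (sp (c ∷ P) , ep (c ∷ P) , toehold (c ∷ P))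
    extend Ls≡c refl =
      trans (bwStep-extend O (trans hr≡ (cong (rank L c s ,_) β≡true)) rk≡) (result≡ rank≡ toehold≡)
      where
      β≡true : (L s ≡ᵇ c) ≡ true
      β≡true = dec-true (L s ≟ c) Ls≡c
      rank≡ : rank L c s ∸ 1 ≡ rank L c (s ∸ 1)
      rank≡ = trans (cong (λ b → rank L c s ∸ indicator b) (sym β≡true)) (rank-before L c 1≤s)
      toehold≡ : SA s ∸ 1 ≡ SA (LF c s)
      toehold≡ = sym (proj₂ (LF-row (1≤s , ≤-trans s≤j₀ j₀≤n) 1≤c Ls≡c))

    first-of-run : L s ≢ c ⊎ (toehold P ≡ nothing × s ≡ 1) →
                   ∀ {j} → s ≤ j → L j ≡ c → (∀ {y} → s ≤ y → y < j → L y ≢ c) → runHead L j ≡ j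
    first-of-run fresh {j} s≤j Lj≡c none-before with m≤n⇒m<n∨m≡n s≤j | fresh
    ... | inj₁ s<j | _ = runHead-start L (≤-trans (s≤s 1≤s) s<j)
      λ L≡L → none-before (<⇒≤∸1 s<j) (≤∸1⇒< (≤-trans 1≤s s≤j) ≤-refl) (trans L≡L Lj≡c)
    ... | inj₂ s≡j | inj₁ Ls≢c       = contradiction (subst (λ x → L x ≡ c) (sym s≡j) Lj≡c) Ls≢c
    ... | inj₂ s≡j | inj₂ (_ , s≡1) = subst (λ x → runHead L x ≡ x) (trans (sym s≡1) s≡j) refl

    relocate : L s ≢ c ⊎ (toehold P ≡ nothing × s ≡ 1) →
               bwStep n S SA O c (s , e , toehold P) ≡ just (sp (c ∷ P) , ep (c ∷ P) , toehold (c ∷ P))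
    relocate fresh with firstOcc-found L c (∈-interval⁺ (s≤j₀ , j₀≤n)) Lj₀≡c
    ... | j , found =
      trans (bwStep-relocate O hr≡ rk≡ (trans sc≡ found) stale) (result≡ (rank-before L c 1≤s) toehold≡)
      where
      j-spec = firstOcc-interval L c s n found
      j∈ = proj₁ j-spec
      Lj≡c = proj₁ (proj₂ j-spec)
      none-before = proj₂ (proj₂ j-spec)
      1≤j = ≤-trans 1≤s (proj₁ j∈)

      stale : (L s ≡ᵇ c) ≡ false ⊎ toehold P ≡ nothing
      stale = ⊎-map (dec-false (L s ≟ c)) proj₁ fresh

      same-rank : rank L c (j ∸ 1) ≡ rank L c (s ∸ 1)
      same-rank = rank-stable L c (∸-monoˡ-≤ 1 (proj₁ j∈))
        λ s∸1<x x≤j∸1 → none-before (∸1<⇒≤ 1≤s s∸1<x) (≤∸1⇒< 1≤j x≤j∸1)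

      toehold≡ : SA (runHead L j) ∸ 1 ≡ SA (LF c s)
      toehold≡ = begin
        SA (runHead L j) ∸ 1
          ≡⟨ cong (λ x → SA x ∸ 1) (first-of-run fresh (proj₁ j∈) Lj≡c none-before) ⟩
        SA j ∸ 1
          ≡⟨ sym (proj₂ (LF-row (1≤j , proj₂ j∈) 1≤c Lj≡c)) ⟩
        SA (LF c j)
          ≡⟨ cong (λ r → SA (C c + r + 1)) same-rank ⟩
        SA (LF c s) ∎
        where open ≡-Reasoning

  bwStep-correct : ∀ (O : Oracle) {c P} → IsPattern σ (c ∷ P) → Occurs n S (c ∷ P) →
    Oracle.hr O c (sp P) ≡ (rank L c (sp P) , (L (sp P) ≡ᵇ c)) →
    Oracle.rk O c (ep P) ≡ rank L c (ep P) →
    Oracle.sc O c (sp P) ≡ succL n L c (sp P) →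
    bwStep n S SA O c (sp P , ep P , toehold P) ≡ just (sp (c ∷ P) , ep (c ∷ P) , toehold (c ∷ P))
  bwStep-correct O {c} {[]}         pat occ hr≡ rk≡ sc≡ =
    Step.relocate O pat occ hr≡ rk≡ sc≡ (inj₂ (refl , refl))
  bwStep-correct O {c} {P@(_ ∷ _)} pat occ hr≡ rk≡ sc≡ with L (sp P) ≟ c
  ... | yes Ls≡c = Step.extend O pat occ hr≡ rk≡ sc≡ Ls≡c refl
  ... | no  Ls≢c = Step.relocate O pat occ hr≡ rk≡ sc≡ (inj₁ Ls≢c)

-- Overlaps and the sampled symbols

module _ (n σ : ℕ) (S SA : ℕ → ℕ) (p q : ℕ) where

  KeepsLeftSymbols KeepsRightSymbols : (ℕ → Bool) → Set
  KeepsLeftSymbols K =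
    ∀ {c s e j} → InLeft n σ S SA p q s e → s ≤ j → j < p → BWT S SA j ≡ c → T (K c)
  KeepsRightSymbols K =
    ∀ {c s e j} → InRight n σ S SA p q s e → q < j → j ≤ e → BWT S SA j ≡ c → T (K c)

module Overlaps (n σ : ℕ) (S SA : ℕ → ℕ) (text : IsText n σ S) (sa : IsSuffixArray n S SA)
                (p q : ℕ) where
  open SuffixArrays n σ S SA text sa
  open BackwardSearch n σ S SA text sa

  InLeft? : ∀ s e → Dec (InLeft n σ S SA p q s e)
  InLeft? s e = InRanges? s e ×-dec s ≤? p ×-dec p ≤? e ×-dec e ≤? q

  InRight? : ∀ s e → Dec (InRight n σ S SA p q s e)
  InRight? s e = InRanges? s e ×-dec p ≤? s ×-dec s ≤? q ×-dec q ≤? e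

  InRanges-ep : ∀ {s e} → InRanges n σ S SA s e → e ≤ n
  InRanges-ep (_ , pat , _ , range) = subst (_≤ n) (cong proj₂ range) (ep-bounded pat)

  LmoOrEmpty RmoOrEmpty : Set
  LmoOrEmpty = (∃[ a ] ∃[ b ] IsLmo n σ S SA p q a b) ⊎ (∀ {s e} → ¬ InLeft n σ S SA p q s e)
  RmoOrEmpty = (∃[ y ] ∃[ z ] IsRmo n σ S SA p q y z) ⊎ (∀ {s e} → ¬ InRight n σ S SA p q s e)

  lmo-or-empty : LmoOrEmpty
  lmo-or-empty with least-below (λ s → anyUpTo? (InLeft? s) (suc q)) (suc p)
  ... | inj₂ none = inj₂ λ left@(_ , s≤p , _ , e≤q) → none (s≤s s≤p) (_ , s≤s e≤q , left)
  ... | inj₁ (a , (e₀ , _ , a-e₀) , a-least) with greatest-below (InLeft? a) (suc q)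
  ...   | inj₂ none = contradiction a-e₀ (none (s≤s (proj₂ (proj₂ (proj₂ a-e₀)))))
  ...   | inj₁ (b , a-b , b-greatest) = inj₁ (a , b , a-b , leftmost)
    where
    leftmost : ∀ s e → InLeft n σ S SA p q s e → a < s ⊎ (a ≡ s × e ≤ b)
    leftmost s e left@(_ , _ , _ , e≤q) with m≤n⇒m<n∨m≡n (a-least (e , s≤s e≤q , left))
    ... | inj₁ a<s  = inj₁ a<s
    ... | inj₂ refl = inj₂ (refl , b-greatest left (s≤s e≤q))

  rmo-or-empty : RmoOrEmpty
  rmo-or-empty with greatest-below (λ e → anyUpTo? (λ s → InRight? s e) (suc q)) (suc n)
  ... | inj₂ none =
    inj₂ λ right@(ranges , _ , s≤q , _) → none (s≤s (InRanges-ep ranges)) (_ , s≤s s≤q , right)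
  ... | inj₁ (z , (s₀ , _ , s₀-z) , z-greatest) with least-below (λ s → InRight? s z) (suc q)
  ...   | inj₂ none = contradiction s₀-z (none (s≤s (proj₁ (proj₂ (proj₂ s₀-z)))))
  ...   | inj₁ (y , y-z , y-least) = inj₁ (y , z , y-z , rightmost)
    where
    rightmost : ∀ s e → InRight n σ S SA p q s e → e < z ⊎ (e ≡ z × y ≤ s)
    rightmost s e right@(ranges , _ , s≤q , _)
      with m≤n⇒m<n∨m≡n (z-greatest (s , s≤s s≤q , right) (s≤s (InRanges-ep ranges)))
    ... | inj₁ e<z  = inj₁ e<z
    ... | inj₂ refl = inj₂ (refl , y-least right)

  left-symbols : LmoOrEmpty → ℕ → Bool
  left-symbols (inj₁ (a , _)) c = occursB L c a (p ∸ 1)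
  left-symbols (inj₂ _)       c = false

  right-symbols : RmoOrEmpty → ℕ → Bool
  right-symbols (inj₁ (_ , z , _)) c = occursB L c (suc q) z
  right-symbols (inj₂ _)           c = false

  left-symbols-sound : ∀ lmo? {c} → T (left-symbols lmo? c) → InSigmaLeft n σ S SA p q c
  left-symbols-sound (inj₁ (a , b , lmo)) occ with occursB-sound occ
  ... | j , (a≤j , j≤p∸1) , Lj≡c = a , b , lmo , j , a≤j , j≤p∸1 , Lj≡c

  right-symbols-sound : ∀ rmo? {c} → T (right-symbols rmo? c) → InSigmaRight n σ S SA p q c
  right-symbols-sound (inj₁ (y , z , rmo)) occ with occursB-sound occ
  ... | j , (q<j , j≤z) , Lj≡c = y , z , rmo , j , q<j , j≤z , Lj≡c

  left-symbols-complete : ∀ lmo? {c s e j} → InLeft n σ S SA p q s e → s ≤ j → j < p → L j ≡ c →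
                          T (left-symbols lmo? c)
  left-symbols-complete (inj₂ empty) left _ _ _ = contradiction left empty
  left-symbols-complete (inj₁ (a , b , _ , leftmost)) {s = s} {e} left s≤j j<p Lj≡c =
    occursB-complete {L} (≤-trans a≤s s≤j , <⇒≤∸1 j<p) Lj≡c
    where
    a≤s : a ≤ s
    a≤s with leftmost s e left
    ... | inj₁ a<s       = <⇒≤ a<s
    ... | inj₂ (refl , _) = ≤-refl

  right-symbols-complete : ∀ rmo? {c s e j} → InRight n σ S SA p q s e → q < j → j ≤ e → L j ≡ c →
                           T (right-symbols rmo? c)
  right-symbols-complete (inj₂ empty) right _ _ _ = contradiction right empty
  right-symbols-complete (inj₁ (y , z , _ , rightmost)) {s = s} {e} right q<j j≤e Lj≡c =
    occursB-complete {L} (q<j , ≤-trans j≤e e≤z) Lj≡c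
    where
    e≤z : e ≤ z
    e≤z with rightmost s e right
    ... | inj₁ e<z       = <⇒≤ e<z
    ... | inj₂ (refl , _) = ≤-refl

  sampled-symbols : ℕ → Bool
  sampled-symbols c = left-symbols lmo-or-empty c ∨ right-symbols rmo-or-empty c

  sampled-symbols-sound : ∀ c → sampled-symbols c ≡ true →
                          InSigmaLeft n σ S SA p q c ⊎ InSigmaRight n σ S SA p q c
  sampled-symbols-sound c K≡true with Equivalence.to T-∨ (Equivalence.from T-≡ K≡true)
  ... | inj₁ left  = inj₁ (left-symbols-sound lmo-or-empty left)
  ... | inj₂ right = inj₂ (right-symbols-sound rmo-or-empty right)

  sampled-symbols-keep-left : KeepsLeftSymbols n σ S SA p q sampled-symbols
  sampled-symbols-keep-left left s≤j j<p Lj≡c =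
    Equivalence.from T-∨ (inj₁ (left-symbols-complete lmo-or-empty left s≤j j<p Lj≡c))

  sampled-symbols-keep-right : KeepsRightSymbols n σ S SA p q sampled-symbols
  sampled-symbols-keep-right right q<j j≤e Lj≡c =
    Equivalence.from T-∨ (inj₂ (right-symbols-complete rmo-or-empty right q<j j≤e Lj≡c))

-- Backward search with the sampled routing array

module SampledSearch (n σ : ℕ) (S SA : ℕ → ℕ) (text : IsText n σ S) (sa : IsSuffixArray n S SA)
                     (p q : ℕ) (K : ℕ → Bool)
                     (keeps-left : KeepsLeftSymbols n σ S SA p q K)
                     (keeps-right : KeepsRightSymbols n σ S SA p q K)
                     where
  open SuffixArrays n σ S SA text sa
  open BackwardSearch n σ S SA text sa
  open SampledOracle n L p q K

  module Routing {c P} (pat : IsPattern σ (c ∷ P)) (occ : Occurs n S (c ∷ P)) where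
    private
      s = sp P
      e = ep P
      witness = symbol-in-range pat occ
      j₀ = proj₁ witness
      s≤j₀ = proj₁ (proj₁ (proj₂ witness))
      j₀≤e = proj₂ (proj₁ (proj₂ witness))
      Lj₀≡c = proj₂ (proj₂ witness)
      ranges : InRanges n σ S SA s e
      ranges = P , All-tail pat , Occurs-tail occ , refl

    sp-query-kept : ∀ {i} → i ≤ s → p ≤ s → s ≤ q → T (occursB L c i q) ⊎ T (K c)
    sp-query-kept i≤s p≤s s≤q with j₀ ≤? q
    ... | yes j₀≤q = inj₁ (occursB-complete {L} (≤-trans i≤s s≤j₀ , j₀≤q) Lj₀≡c)
    ... | no  j₀≰q = inj₂ (keeps-right (ranges , p≤s , s≤q , ≤-trans (<⇒≤ q<j₀) j₀≤e) q<j₀ j₀≤e Lj₀≡c)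
      where q<j₀ = ≰⇒> j₀≰q

    ep-query-kept : p ≤ e → e ≤ q → T (occursB L c p q) ⊎ T (K c)
    ep-query-kept p≤e e≤q with p ≤? j₀
    ... | yes p≤j₀ = inj₁ (occursB-complete {L} (p≤j₀ , ≤-trans j₀≤e e≤q) Lj₀≡c)
    ... | no  p≰j₀ = inj₂ (keeps-left (ranges , ≤-trans s≤j₀ (<⇒≤ j₀<p) , p≤e , e≤q) s≤j₀ j₀<p Lj₀≡c)
      where j₀<p = ≰⇒> p≰j₀

  sampled-search : ∀ P → IsPattern σ P → Occurs n S P →
    backwardSearch n S SA (sampledOracle n L p q K) P ≡ just (sp P , ep P , toehold P)
  sampled-search []      _   _   = refl
  sampled-search (c ∷ P) pat occ rewrite sampled-search P (All-tail pat) (Occurs-tail occ) =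
    bwStep-correct (sampledOracle n L p q K) pat occ
      (sampled-hr (λ p≤s s≤q → sp-query-kept p≤s p≤s s≤q))
      (sampled-rk ep-query-kept)
      (sampled-sc (λ p≤s s≤q → sp-query-kept ≤-refl p≤s s≤q))
    where open Routing pat occ

lemma5p1 : (n σ : ℕ) (S SA : ℕ → ℕ) → IsText n σ S → IsSuffixArray n S SA →
    (ℓ p q : ℕ) → IsRootFragment n ℓ p q →
    ∃[ K ] ((∀ c → K c ≡ true →
               InSigmaLeft n σ S SA p q c ⊎ InSigmaRight n σ S SA p q c) ×
            (∀ (c : ℕ) (P : List ℕ) → IsPattern σ (c ∷ P) → Occurs n S (c ∷ P) →
               backwardSearch n S SA (sampledOracle n (BWT S SA) p q K) (c ∷ P)
                 ≡ correctResult n S SA (c ∷ P)))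
lemma5p1 n σ S SA text sa ℓ p q _ =
  sampled-symbols , sampled-symbols-sound , λ c P → sampled-search (c ∷ P)
  where
  open Overlaps n σ S SA text sa p q
  open SampledSearch n σ S SA text sa p q sampled-symbols sampled-symbols-keep-left sampled-symbols-keep-right
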